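{- Define $\mu_{2,i}=2$ and $\mu_{3,i}=i+1$ for all $i\ge0$; for $s\ge4$, $\mu_{s,0}=1$ and $\mu_{s,i}=\mu_{s,i-1}\mu_{s-2,i}$ for $i\ge1$. Let $t=\lfloor(s-2)/2\rfloor$. Then: (1) for even $s\ge2$, $\mu_{s,i}=2^{\binom{i+t-1}{t}}=2^{i^t/t!+O(i^{t-1})}$; (2) for odd $s\ge5$, $\mu_{s,i}=\prod_{l=0}^{i}(i+1-l)^{\binom{l+t-1}{t-1}}=2^{i^t(\log i)/t!+O(i^t)}$.
   Context: $\log$ is base 2; asymptotic notation is as $i\to\infty$ with $s$ fixed. -}

module Defs where

open import Data.Nat using (ℕ; zero; suc; _+_; _*_; _∸_; _^_)
open import Data.List using (map; upTo)
open import Data.Nat.ListAction using (product)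

-- μ_{s,i}.  Values for s < 2 are irrelevant (not defined in the paper); set to 1.
mu : ℕ → ℕ → ℕ
mu zero i = 1
mu (suc zero) i = 1
mu (suc (suc zero)) i = 2
mu (suc (suc (suc zero))) i = suc i
mu (suc (suc (suc (suc s)))) zero = 1
mu (suc (suc (suc (suc s)))) (suc i) =
  mu (suc (suc (suc (suc s)))) i * mu (suc (suc s)) (suc i)

prodUpTo : ℕ → (ℕ → ℕ) → ℕ
prodUpTo n f = product (map f (upTo (suc n)))

-- Closed forms.  Both follow by induction on s and i from the recursion,
-- because each step is Pascal's rule in the exponent: for even s = 2t + 2,
-- μ = 2^C(i+t-1,t); for odd s = 2t + 3 with t ≥ 1,
-- μ = ∏_{l≤i} (i+1-l)^C(l+t-1,t-1).
--
-- Even growth.  t! C(i+t-1,t) is the falling factorial (i+t-1)⋯i, which lies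
-- between i^t and (i+t)^t = i^t + O(i^(t-1)).
--
-- Odd growth.  Write x ≈_E y ("Close E x y") when x ≤ y 2^E and y ≤ x 2^E;
-- this is stable under products, powers and composition.  For s = 2u + 3 we
-- show μ_{s,j}^{u!} ≈_{K j^u} j^(j^u) by induction on u (base s = 3).  Since
-- μ_{s+2,i} = ∏_{j≤i} μ_{s,j}, raising to t = u + 1 gives
-- μ_{s+2,i}^{t!} ≈ (∏_{j≤i} j^(j^u))^t, and this last product is ≈ i^(i^t):
-- the upper bound because t Σ_{j≤i} j^u ≤ i^t + t i^u, the lower bound by
-- telescoping (m+1)^((m+1)^t) against m^(m^t), using (1 + 1/m)^m ≤ 4.
module Submission where

open import Defs
open import Data.Nat using (ℕ; zero; suc; _+_; _*_; _∸_; _^_; _≤_; _/_; _!; z≤n; s≤s)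
open import Data.Nat.Properties
open import Data.Nat.Combinatorics
  using (_C_; _P_; nCk+nC[k+1]≡[n+1]C[k+1]; k>n⇒nCk≡0; nCn≡1; nCk≡nPk/k!; nPk≡n!/[n∸k]!)
open import Data.Nat.Combinatorics.Base using (_P′_)
open import Data.Nat.Combinatorics.Specification using (nP′k≡n!/[n∸k]!; k!∣nP′k)
open import Data.Nat.DivMod using (m*[n/m]≡n; m*n/n≡m; +-distrib-/-∣ʳ)
open import Data.Nat.Divisibility using (_∣_; divides; ∣-refl; ∣m∣n⇒∣m+n)
open import Data.List using (map; applyUpTo)
open import Data.Nat.ListAction using (product)
open import Data.Product using (_×_; ∃-syntax; _,_)
open import Data.Empty using (⊥-elim)
open import Relation.Nullary using (¬_)
open import Relation.Binary.PropositionalEquality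
open import Data.Nat.Tactic.RingSolver

prodBelow : ℕ → (ℕ → ℕ) → ℕ
prodBelow zero f = 1
prodBelow (suc n) f = f 0 * prodBelow n (λ l → f (suc l))

product-applyUpTo : ∀ n (f g : ℕ → ℕ) →
  product (map f (applyUpTo g n)) ≡ prodBelow n (λ l → f (g l))
product-applyUpTo zero f g = refl
product-applyUpTo (suc n) f g = cong (f (g 0) *_) (product-applyUpTo n f (λ l → g (suc l)))

prodUpTo≡prodBelow : ∀ n f → prodUpTo n f ≡ prodBelow (suc n) f
prodUpTo≡prodBelow n f = product-applyUpTo (suc n) f (λ l → l)

prodBelow-cong : ∀ n {f g : ℕ → ℕ} → (∀ l → f l ≡ g l) → prodBelow n f ≡ prodBelow n g
prodBelow-cong zero eq = refl
prodBelow-cong (suc n) eq = cong₂ _*_ (eq 0) (prodBelow-cong n (λ l → eq (suc l)))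

prodBelow-* : ∀ n (f g : ℕ → ℕ) →
  prodBelow n (λ l → f l * g l) ≡ prodBelow n f * prodBelow n g
prodBelow-* zero f g = refl
prodBelow-* (suc n) f g = begin
    f 0 * g 0 * prodBelow n (λ l → f (suc l) * g (suc l))
  ≡⟨ cong (f 0 * g 0 *_) (prodBelow-* n (λ l → f (suc l)) (λ l → g (suc l))) ⟩
    f 0 * g 0 * (prodBelow n (λ l → f (suc l)) * prodBelow n (λ l → g (suc l)))
  ≡⟨ interchange (f 0) (g 0) _ _ ⟩
    f 0 * prodBelow n (λ l → f (suc l)) * (g 0 * prodBelow n (λ l → g (suc l))) ∎
  where
  open ≡-Reasoning
  interchange : ∀ a b c d → a * b * (c * d) ≡ a * c * (b * d)
  interchange = solve-∀

-- Closed form for even s = 2t + 2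

even-pascal : ∀ i t → (i + suc t ∸ 1) C suc t + (i + t) C t ≡ (i + suc t) C suc t
even-pascal i t rewrite +-suc i t =
  trans (+-comm ((i + t) C suc t) _) (nCk+nC[k+1]≡[n+1]C[k+1] (i + t) t)

mu-even : ∀ t i → mu (suc (suc (t * 2))) i ≡ 2 ^ ((i + t ∸ 1) C t)
mu-even zero i = refl
mu-even (suc t) zero = cong (2 ^_) (sym (k>n⇒nCk≡0 (n<1+n t)))
mu-even (suc t) (suc i) = begin
    mu (suc (suc (suc t * 2))) i * mu (suc (suc (t * 2))) (suc i)
  ≡⟨ cong₂ _*_ (mu-even (suc t) i) (mu-even t (suc i)) ⟩
    2 ^ ((i + suc t ∸ 1) C suc t) * 2 ^ ((i + t) C t)
  ≡⟨ sym (^-distribˡ-+-* 2 ((i + suc t ∸ 1) C suc t) ((i + t) C t)) ⟩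
    2 ^ ((i + suc t ∸ 1) C suc t + (i + t) C t)
  ≡⟨ cong (2 ^_) (even-pascal i t) ⟩
    2 ^ ((i + suc t) C suc t) ∎
  where open ≡-Reasoning

-- Closed form for odd s = 2u + 5  (t = u + 1)

-- The exponent C(l+u, u), written as C(l+t-1, t-1).
oddExp : ℕ → ℕ → ℕ
oddExp u l = (l + suc u ∸ 1) C u

oddExp-zero : ∀ u → oddExp u 0 ≡ 1
oddExp-zero u = nCn≡1 u

odd-pascal : ∀ u l → oddExp (suc u) (suc l) ≡ oddExp (suc u) l + oddExp u (suc l)
odd-pascal u l rewrite +-suc l (suc u) =
  trans (sym (nCk+nC[k+1]≡[n+1]C[k+1] (l + suc u) u))
        (+-comm ((l + suc u) C u) ((l + suc u) C suc u))

-- P_u(i) = ∏_{l≤i} (i+1-l)^C(l+u,u).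
oddProduct : ℕ → ℕ → ℕ
oddProduct u i = prodBelow (suc i) (λ l → (suc i ∸ l) ^ oddExp u l)

oddProduct-zero : ∀ u → oddProduct u 0 ≡ 1
oddProduct-zero u = trans (*-identityʳ (1 ^ oddExp u 0)) (^-zeroˡ (oddExp u 0))

oddProduct-first-step : ∀ i → oddProduct 0 (suc i) ≡ oddProduct 0 i * suc (suc i)
oddProduct-first-step i = begin
    suc (suc i) * 1 * oddProduct 0 i  ≡⟨ cong (_* oddProduct 0 i) (*-identityʳ (suc (suc i))) ⟩
    suc (suc i) * oddProduct 0 i      ≡⟨ *-comm (suc (suc i)) (oddProduct 0 i) ⟩
    oddProduct 0 i * suc (suc i)      ∎
  where open ≡-Reasoning

-- P_{u+1}(i+1) = P_{u+1}(i) P_u(i+1): split off l = 0 and apply Pascal's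
-- rule to every other exponent.
oddProduct-step : ∀ u i → oddProduct (suc u) (suc i) ≡ oddProduct (suc u) i * oddProduct u (suc i)
oddProduct-step u i = begin
    n ^ oddExp (suc u) 0 * prodBelow (suc i) (λ l → (suc i ∸ l) ^ oddExp (suc u) (suc l))
  ≡⟨ cong₂ _*_ (cong (n ^_) (oddExp-zero (suc u))) (prodBelow-cong (suc i) pascal-factor) ⟩
    n ^ 1 * prodBelow (suc i) (λ l → (suc i ∸ l) ^ oddExp (suc u) l * (suc i ∸ l) ^ oddExp u (suc l))
  ≡⟨ cong (n ^ 1 *_) (prodBelow-* (suc i) (λ l → (suc i ∸ l) ^ oddExp (suc u) l)
                                          (λ l → (suc i ∸ l) ^ oddExp u (suc l))) ⟩
    n ^ 1 * (A * B)
  ≡⟨ rotate (n ^ 1) A B ⟩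
    A * (n ^ 1 * B)
  ≡⟨ cong (λ e → A * (n ^ e * B)) (sym (oddExp-zero u)) ⟩
    A * (n ^ oddExp u 0 * B) ∎
  where
  open ≡-Reasoning
  n = suc (suc i)
  A = oddProduct (suc u) i
  B = prodBelow (suc i) (λ l → (suc i ∸ l) ^ oddExp u (suc l))
  pascal-factor : ∀ l → (suc i ∸ l) ^ oddExp (suc u) (suc l)
                      ≡ (suc i ∸ l) ^ oddExp (suc u) l * (suc i ∸ l) ^ oddExp u (suc l)
  pascal-factor l = trans (cong ((suc i ∸ l) ^_) (odd-pascal u l))
                          (^-distribˡ-+-* (suc i ∸ l) (oddExp (suc u) l) (oddExp u (suc l)))
  rotate : ∀ a b c → a * (b * c) ≡ b * (a * c)
  rotate = solve-∀

oddMu : ℕ → ℕ → ℕ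
oddMu u = mu (suc (suc (suc (u * 2))))

-- Claim (2), closed form: μ_{2u+5} satisfies the recursion of P_u.
mu-odd : ∀ u i → oddMu (suc u) i ≡ oddProduct u i
mu-odd u zero = sym (oddProduct-zero u)
mu-odd zero (suc i) = trans (cong (_* suc (suc i)) (mu-odd zero i)) (sym (oddProduct-first-step i))
mu-odd (suc u) (suc i) =
  trans (cong₂ _*_ (mu-odd (suc u) i) (mu-odd u (suc i))) (sym (oddProduct-step u i))

power-of-product : ∀ a b n → (a * b) ^ n ≡ a ^ n * b ^ n
power-of-product a b zero = refl
power-of-product a b (suc n) = trans (cong (a * b *_) (power-of-product a b n)) (interchange a b (a ^ n) (b ^ n))
  where
  interchange : ∀ a b x y → a * b * (x * y) ≡ a * x * (b * y)
  interchange = solve-∀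

1≤2^ : ∀ n → 1 ≤ 2 ^ n
1≤2^ n = m^n>0 2 n

n≤2^n : ∀ n → n ≤ 2 ^ n
n≤2^n zero = z≤n
n≤2^n (suc n) = +-mono-≤ (1≤2^ n) (≤-trans (n≤2^n n) (m≤m+n (2 ^ n) 0))

-- x^(u+1) + (u+1) x^u ≤ (x+1)^(u+1): the first two binomial terms.
binomial-lower : ∀ x u → x ^ suc u + suc u * x ^ u ≤ suc x ^ suc u
binomial-lower x zero = ≤-reflexive (e x)
  where
  e : ∀ x → x * 1 + 1 * 1 ≡ (1 + x) * 1
  e = solve-∀
binomial-lower x (suc u) = begin
    x * (x * B) + (2 + u) * (x * B)
  ≤⟨ m≤m+n _ ((1 + u) * B) ⟩
    x * (x * B) + (2 + u) * (x * B) + (1 + u) * B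
  ≡⟨ e x u B ⟩
    (1 + x) * (x * B + (1 + u) * B)
  ≤⟨ *-monoʳ-≤ (1 + x) (binomial-lower x u) ⟩
    (1 + x) * (suc x ^ suc u) ∎
  where
  open ≤-Reasoning
  B = x ^ u
  e : ∀ x u B → x * (x * B) + (2 + u) * (x * B) + (1 + u) * B ≡ (1 + x) * (x * B + (1 + u) * B)
  e = solve-∀

binomial-upper : ∀ m u → suc m ^ suc u ≤ m ^ suc u + suc u * suc m ^ u
binomial-upper m zero = ≤-reflexive (e m)
  where
  e : ∀ m → (1 + m) * 1 ≡ m * 1 + 1 * 1
  e = solve-∀
binomial-upper m (suc u) = begin
    (1 + m) * ((1 + m) * D)
  ≤⟨ *-monoʳ-≤ (1 + m) (binomial-upper m u) ⟩
    (1 + m) * (m * B + (1 + u) * D)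
  ≡⟨ e₁ m u B D ⟩
    m * (m * B) + (m * B + (1 + u) * ((1 + m) * D))
  ≤⟨ +-monoʳ-≤ (m * (m * B)) (+-monoˡ-≤ ((1 + u) * ((1 + m) * D)) (^-monoˡ-≤ (suc u) (n≤1+n m))) ⟩
    m * (m * B) + ((1 + m) * D + (1 + u) * ((1 + m) * D))
  ≡⟨ e₂ m u B D ⟩
    m * (m * B) + (2 + u) * ((1 + m) * D) ∎
  where
  open ≤-Reasoning
  B = m ^ u
  D = suc m ^ u
  e₁ : ∀ m u B D → (1 + m) * (m * B + (1 + u) * D) ≡ m * (m * B) + (m * B + (1 + u) * ((1 + m) * D))
  e₁ = solve-∀
  e₂ : ∀ m u B D → m * (m * B) + ((1 + m) * D + (1 + u) * ((1 + m) * D)) ≡ m * (m * B) + (2 + u) * ((1 + m) * D)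
  e₂ = solve-∀

-- The constant in (n + c)^(u+1) = n^(u+1) + O(n^u).
shiftConstant : ℕ → ℕ → ℕ
shiftConstant c zero = c
shiftConstant c (suc u) = shiftConstant c u + c + c * shiftConstant c u

shifted-power-bound : ∀ c u j →
  (suc j + c) ^ suc u ≤ suc j ^ suc u + shiftConstant c u * suc j ^ u
shifted-power-bound c zero j = ≤-reflexive (e j c)
  where
  e : ∀ j c → (1 + j + c) * 1 ≡ (1 + j) * 1 + c * 1
  e = solve-∀
shifted-power-bound c (suc u) j = begin
    (n + c) * ((n + c) ^ suc u)
  ≤⟨ *-monoʳ-≤ (n + c) (shifted-power-bound c u j) ⟩
    (n + c) * (n * B + K * B)
  ≡⟨ e₁ n c K B ⟩
    n * (n * B) + K * (n * B) + c * (n * B) + c * K * B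
  ≤⟨ +-monoʳ-≤ (n * (n * B) + K * (n * B) + c * (n * B)) (*-monoʳ-≤ (c * K) (m≤m+n B (j * B))) ⟩
    n * (n * B) + K * (n * B) + c * (n * B) + c * K * (n * B)
  ≡⟨ e₂ n c K B ⟩
    n * (n * B) + (K + c + c * K) * (n * B) ∎
  where
  open ≤-Reasoning
  n = suc j
  B = n ^ u
  K = shiftConstant c u
  e₁ : ∀ n c K B → (n + c) * (n * B + K * B) ≡ n * (n * B) + K * (n * B) + c * (n * B) + c * K * B
  e₁ = solve-∀
  e₂ : ∀ n c K B → n * (n * B) + K * (n * B) + c * (n * B) + c * K * (n * B) ≡ n * (n * B) + (K + c + c * K) * (n * B)
  e₂ = solve-∀

-- (1 + 1/n)^k ≤ n/(n-k) for k ≤ n, written with n = k + a.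
power-ratio-bound : ∀ k a → suc (k + a) ^ k * a ≤ (k + a) ^ suc k
power-ratio-bound zero a = ≤-reflexive (e a)
  where
  e : ∀ a → 1 * a ≡ a * 1
  e = solve-∀
power-ratio-bound (suc k) a = begin
    (suc n * X) * a   ≡⟨ e₁ n X a ⟩
    X * (suc n * a)   ≤⟨ *-monoʳ-≤ X shift ⟩
    X * (n * suc a)   ≡⟨ e₂ n X a ⟩
    n * (X * suc a)   ≤⟨ *-monoʳ-≤ n previous ⟩
    n * (n ^ suc k)   ∎
  where
  open ≤-Reasoning
  n = suc (k + a)
  X = suc n ^ k
  previous : X * suc a ≤ n ^ suc k
  previous = subst (λ m → suc m ^ k * suc a ≤ m ^ suc k) (+-suc k a) (power-ratio-bound k (suc a))
  shift : suc n * a ≤ n * suc a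
  shift = begin
      suc n * a  ≡⟨⟩
      a + n * a  ≤⟨ +-monoˡ-≤ (n * a) (≤-trans (m≤n+m a k) (n≤1+n (k + a))) ⟩
      n + n * a  ≡⟨ sym (*-suc n a) ⟩
      n * suc a  ∎
  e₁ : ∀ n X a → ((1 + n) * X) * a ≡ X * ((1 + n) * a)
  e₁ = solve-∀
  e₂ : ∀ n X a → X * (n * (1 + a)) ≡ n * (X * (1 + a))
  e₂ = solve-∀

half-ratio-even : ∀ m → suc (m + m) ^ m ≤ 2 * (m + m) ^ m
half-ratio-even zero = s≤s z≤n
half-ratio-even m@(suc _) = *-cancelʳ-≤ _ _ m (begin
    suc (m + m) ^ m * m  ≤⟨ power-ratio-bound m m ⟩
    (m + m) ^ suc m      ≡⟨ e m ((m + m) ^ m) ⟩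
    2 * (m + m) ^ m * m  ∎)
  where
  open ≤-Reasoning
  e : ∀ m X → (m + m) * X ≡ 2 * X * m
  e = solve-∀

half-ratio-odd : ∀ m → suc (suc (m + m)) ^ m ≤ 2 * suc (m + m) ^ m
half-ratio-odd m = *-cancelʳ-≤ _ _ (suc m) (begin
    suc (suc (m + m)) ^ m * suc m  ≡⟨ cong (λ n → suc n ^ m * suc m) (sym (+-suc m m)) ⟩
    suc (m + suc m) ^ m * suc m    ≤⟨ power-ratio-bound m (suc m) ⟩
    (m + suc m) ^ suc m            ≡⟨ cong (_^ suc m) (+-suc m m) ⟩
    suc (m + m) * X                ≤⟨ *-monoˡ-≤ X (m≤m+n (suc (m + m)) 1) ⟩
    (suc (m + m) + 1) * X          ≡⟨ e m X ⟩
    2 * X * suc m                  ∎)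
  where
  open ≤-Reasoning
  X = suc (m + m) ^ m
  e : ∀ m X → (1 + (m + m) + 1) * X ≡ 2 * X * (1 + m)
  e = solve-∀

-- (1 + 1/m)^m ≤ 4, from the two half steps 2m → 2m+1 → 2m+2.
succ-power-bound : ∀ m → suc m ^ m ≤ 4 * m ^ m
succ-power-bound m = *-cancelˡ-≤ (2 ^ m) {{m^n≢0 2 m}} (begin
    2 ^ m * suc m ^ m              ≡⟨ sym (power-of-product 2 (suc m) m) ⟩
    (2 * suc m) ^ m                ≡⟨ cong (_^ m) (e₁ m) ⟩
    suc (suc (m + m)) ^ m          ≤⟨ half-ratio-odd m ⟩
    2 * suc (m + m) ^ m            ≤⟨ *-monoʳ-≤ 2 (half-ratio-even m) ⟩
    2 * (2 * (m + m) ^ m)          ≡⟨ cong (λ n → 2 * (2 * n ^ m)) (e₂ m) ⟩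
    2 * (2 * (2 * m) ^ m)          ≡⟨ cong (λ n → 2 * (2 * n)) (power-of-product 2 m m) ⟩
    2 * (2 * (2 ^ m * m ^ m))      ≡⟨ e₃ (2 ^ m) (m ^ m) ⟩
    2 ^ m * (4 * m ^ m)            ∎)
  where
  open ≤-Reasoning
  e₁ : ∀ m → 2 * (1 + m) ≡ 2 + (m + m)
  e₁ = solve-∀
  e₂ : ∀ m → m + m ≡ 2 * m
  e₂ = solve-∀
  e₃ : ∀ A B → 2 * (2 * (A * B)) ≡ A * (4 * B)
  e₃ = solve-∀

-- Growth for even s: t! C(i+t-1, t) is the falling factorial (i+t-1)⋯i.

factorial-times-binomial : ∀ n k → k ≤ n → k ! * (n C k) ≡ n P′ k
factorial-times-binomial n k k≤n =
  trans (cong (k ! *_) (nCk≡nPk/k! k≤n))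
        (trans (cong (λ z → k ! * (z / k !)) P≡P′) (m*[n/m]≡n (k!∣nP′k k≤n)))
  where
  instance _ = k !≢0
  P≡P′ : n P k ≡ n P′ k
  P≡P′ = trans (nPk≡n!/[n∸k]! k≤n) (sym (nP′k≡n!/[n∸k]! k≤n))

falling-lower : ∀ k j → suc j ^ k ≤ (j + k) P′ k
falling-lower zero j = ≤-refl
falling-lower (suc k) j rewrite +-suc j k =
  *-mono-≤ (≤-reflexive (sym (m+n∸n≡m (suc j) k)))
           (≤-trans (^-monoˡ-≤ k (n≤1+n (suc j))) (falling-lower k (suc j)))

falling-upper : ∀ k j → (j + k) P′ k ≤ (j + k) ^ k
falling-upper zero j = ≤-refl
falling-upper (suc k) j rewrite +-suc j k = *-mono-≤ (m∸n≤m (suc (j + k)) k) (falling-upper k (suc j))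

even-growth : ∀ t → ∃[ K ] ∃[ N ] ((i : ℕ) → N ≤ i →
  (i * ((t !) * ((i + t ∸ 1) C t)) ≤ i * i ^ t + K * i ^ t)
  × (i * i ^ t ≤ i * ((t !) * ((i + t ∸ 1) C t)) + K * i ^ t))
even-growth zero = 0 , 0 , λ i _ → m≤m+n (i * 1) 0 , m≤m+n (i * 1) 0
even-growth (suc u) = shiftConstant t u , 1 , λ { zero () ; (suc j) _ → upper j , lower j }
  where
  t = suc u
  falling : ∀ j → t ! * ((j + t) C t) ≡ (j + t) P′ t
  falling j = factorial-times-binomial (j + t) t (m≤n+m t j)
  upper : ∀ j → suc j * (t ! * ((j + t) C t)) ≤ suc j * suc j ^ t + shiftConstant t u * suc j ^ t
  upper j = begin
      i * (t ! * ((j + t) C t))                ≡⟨ cong (i *_) (falling j) ⟩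
      i * ((j + t) P′ t)                       ≤⟨ *-monoʳ-≤ i (falling-upper t j) ⟩
      i * ((j + t) ^ t)                        ≤⟨ *-monoʳ-≤ i (^-monoˡ-≤ t (n≤1+n (j + t))) ⟩
      i * ((i + t) ^ t)                        ≤⟨ *-monoʳ-≤ i (shifted-power-bound t u j) ⟩
      i * (i ^ t + shiftConstant t u * i ^ u)  ≡⟨ e i (i ^ t) (shiftConstant t u) (i ^ u) ⟩
      i * i ^ t + shiftConstant t u * i ^ t    ∎
    where
    open ≤-Reasoning
    i = suc j
    e : ∀ i A K B → i * (A + K * B) ≡ i * A + K * (i * B)
    e = solve-∀
  lower : ∀ j → suc j * suc j ^ t ≤ suc j * (t ! * ((j + t) C t)) + shiftConstant t u * suc j ^ t
  lower j = ≤-trans (*-monoʳ-≤ (suc j) (≤-trans (falling-lower t j) (≤-reflexive (sym (falling j)))))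
                    (m≤m+n _ _)

Close : ℕ → ℕ → ℕ → Set
Close E x y = (x ≤ y * 2 ^ E) × (y ≤ x * 2 ^ E)

Close-refl : ∀ E x → Close E x x
Close-refl E x = m≤m*n x (2 ^ E) {{m^n≢0 2 E}} , m≤m*n x (2 ^ E) {{m^n≢0 2 E}}

Close-mono : ∀ {E F x y} → E ≤ F → Close E x y → Close F x y
Close-mono {x = x} {y} E≤F (x≤ , y≤) =
  ≤-trans x≤ (*-monoʳ-≤ y (^-monoʳ-≤ 2 E≤F)) , ≤-trans y≤ (*-monoʳ-≤ x (^-monoʳ-≤ 2 E≤F))

scaled-* : ∀ {a b c d E F} → a ≤ b * 2 ^ E → c ≤ d * 2 ^ F → a * c ≤ b * d * 2 ^ (E + F)
scaled-* {b = b} {d = d} {E} {F} a≤ c≤ = ≤-trans (*-mono-≤ a≤ c≤) (≤-reflexive (begin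
    b * 2 ^ E * (d * 2 ^ F)  ≡⟨ interchange b (2 ^ E) d (2 ^ F) ⟩
    b * d * (2 ^ E * 2 ^ F)  ≡⟨ cong (b * d *_) (sym (^-distribˡ-+-* 2 E F)) ⟩
    b * d * 2 ^ (E + F)      ∎))
  where
  open ≡-Reasoning
  interchange : ∀ a b c d → a * b * (c * d) ≡ a * c * (b * d)
  interchange = solve-∀

Close-* : ∀ {E F x y x′ y′} → Close E x y → Close F x′ y′ → Close (E + F) (x * x′) (y * y′)
Close-* {E} {F} {x} {y} {x′} {y′} (x≤ , y≤) (x′≤ , y′≤) =
  scaled-* {b = y} {d = y′} {E} {F} x≤ x′≤ , scaled-* {b = x} {d = x′} {E} {F} y≤ y′≤

scaled-^ : ∀ {a b E} n → a ≤ b * 2 ^ E → a ^ n ≤ b ^ n * 2 ^ (E * n)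
scaled-^ {a} {b} {E} n a≤ = ≤-trans (^-monoˡ-≤ n a≤) (≤-reflexive (begin
    (b * 2 ^ E) ^ n        ≡⟨ power-of-product b (2 ^ E) n ⟩
    b ^ n * (2 ^ E) ^ n    ≡⟨ cong (b ^ n *_) (^-*-assoc 2 E n) ⟩
    b ^ n * 2 ^ (E * n)    ∎))
  where open ≡-Reasoning

Close-^ : ∀ {E x y} n → Close E x y → Close (E * n) (x ^ n) (y ^ n)
Close-^ {E} {x} {y} n (x≤ , y≤) = scaled-^ {b = y} {E} n x≤ , scaled-^ {b = x} {E} n y≤

scaled-trans : ∀ {a b c E F} → a ≤ b * 2 ^ E → b ≤ c * 2 ^ F → a ≤ c * 2 ^ (F + E)
scaled-trans {a} {b} {c} {E} {F} a≤ b≤ = begin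
    a                      ≤⟨ a≤ ⟩
    b * 2 ^ E              ≤⟨ *-monoˡ-≤ (2 ^ E) b≤ ⟩
    c * 2 ^ F * 2 ^ E      ≡⟨ *-assoc c (2 ^ F) (2 ^ E) ⟩
    c * (2 ^ F * 2 ^ E)    ≡⟨ cong (c *_) (sym (^-distribˡ-+-* 2 F E)) ⟩
    c * 2 ^ (F + E)        ∎
  where open ≤-Reasoning

Close-trans : ∀ {E F x y z} → Close E x y → Close F y z → Close (E + F) x z
Close-trans {E} {F} {x} {y} {z} (x≤ , y≤) (y′≤ , z≤) =
    subst (λ G → x ≤ z * 2 ^ G) (+-comm F E) (scaled-trans {b = y} {c = z} {E} {F} x≤ y′≤)
  , scaled-trans {b = y} {c = x} {F} {E} z≤ y≤

-- The comparison products  S_u(i) = Σ_{j=1}^{i} j^u  and  V_u(i) = ∏_{j=1}^{i} j^(j^u)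

powerSum : ℕ → ℕ → ℕ
powerSum u zero = 0
powerSum u (suc i) = powerSum u i + suc i ^ u

selfPowerProduct : ℕ → ℕ → ℕ
selfPowerProduct u zero = 1
selfPowerProduct u (suc i) = selfPowerProduct u i * suc i ^ (suc i ^ u)

-- (u+1) S_u(i) ≤ i^(u+1) + (u+1) i^u: sum the binomial lower bounds.
powerSum-bound : ∀ u i → suc u * powerSum u i ≤ i ^ suc u + suc u * i ^ u
powerSum-bound u zero = ≤-trans (≤-reflexive (*-zeroʳ (suc u))) z≤n
powerSum-bound u (suc i) = begin
    t * (powerSum u i + suc i ^ u)           ≡⟨ *-distribˡ-+ t (powerSum u i) (suc i ^ u) ⟩
    t * powerSum u i + t * suc i ^ u         ≤⟨ +-monoˡ-≤ (t * suc i ^ u) (powerSum-bound u i) ⟩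
    i ^ t + t * i ^ u + t * suc i ^ u        ≤⟨ +-monoˡ-≤ (t * suc i ^ u) (binomial-lower i u) ⟩
    suc i ^ t + t * suc i ^ u                ∎
  where
  open ≤-Reasoning
  t = suc u

powerSum-linear : ∀ u j → suc u * powerSum u (suc j) ≤ (2 + u) * suc j ^ suc u
powerSum-linear u j = begin
    suc u * powerSum u i           ≤⟨ powerSum-bound u i ⟩
    i ^ suc u + suc u * i ^ u      ≤⟨ +-monoʳ-≤ (i ^ suc u) (*-monoʳ-≤ (suc u) (^-monoʳ-≤ i (n≤1+n u))) ⟩
    i ^ suc u + suc u * i ^ suc u  ≡⟨⟩
    (2 + u) * i ^ suc u            ∎
  where
  open ≤-Reasoning
  i = suc j

selfPowerProduct-upper : ∀ u i → selfPowerProduct u i ≤ i ^ powerSum u i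
selfPowerProduct-upper u zero = ≤-refl
selfPowerProduct-upper u (suc i) = begin
    selfPowerProduct u i * suc i ^ W   ≤⟨ *-monoˡ-≤ (suc i ^ W) (selfPowerProduct-upper u i) ⟩
    i ^ S * suc i ^ W                  ≤⟨ *-monoˡ-≤ (suc i ^ W) (^-monoˡ-≤ S (n≤1+n i)) ⟩
    suc i ^ S * suc i ^ W              ≡⟨ sym (^-distribˡ-+-* (suc i) S W) ⟩
    suc i ^ (S + W)                    ∎
  where
  open ≤-Reasoning
  S = powerSum u i
  W = suc i ^ u

self-power-step : ∀ m u →
  suc m ^ (suc m ^ suc u) ≤ m ^ (m ^ suc u) * (suc m ^ (suc m ^ u)) ^ suc u * 4 ^ (m ^ u)
self-power-step m u = begin
    suc m ^ (suc m ^ suc u)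
  ≤⟨ ^-monoʳ-≤ (suc m) (binomial-upper m u) ⟩
    suc m ^ (m ^ suc u + suc u * W)
  ≡⟨ ^-distribˡ-+-* (suc m) (m ^ suc u) (suc u * W) ⟩
    suc m ^ (m * m ^ u) * suc m ^ (suc u * W)
  ≡⟨ cong₂ _*_ (sym (^-*-assoc (suc m) m (m ^ u)))
               (trans (cong (suc m ^_) (*-comm (suc u) W)) (sym (^-*-assoc (suc m) W (suc u)))) ⟩
    (suc m ^ m) ^ (m ^ u) * (suc m ^ W) ^ suc u
  ≤⟨ *-monoˡ-≤ ((suc m ^ W) ^ suc u) (^-monoˡ-≤ (m ^ u) (succ-power-bound m)) ⟩
    (4 * m ^ m) ^ (m ^ u) * (suc m ^ W) ^ suc u
  ≡⟨ cong (_* (suc m ^ W) ^ suc u)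
          (trans (power-of-product 4 (m ^ m) (m ^ u)) (cong (4 ^ (m ^ u) *_) (^-*-assoc m m (m ^ u)))) ⟩
    4 ^ (m ^ u) * m ^ (m * m ^ u) * (suc m ^ W) ^ suc u
  ≡⟨ rotate (4 ^ (m ^ u)) (m ^ (m * m ^ u)) ((suc m ^ W) ^ suc u) ⟩
    m ^ (m ^ suc u) * (suc m ^ W) ^ suc u * 4 ^ (m ^ u) ∎
  where
  open ≤-Reasoning
  W = suc m ^ u
  rotate : ∀ a b c → a * b * c ≡ b * c * a
  rotate = solve-∀

selfPowerProduct-lower : ∀ u i →
  i ^ (i ^ suc u) ≤ selfPowerProduct u i ^ suc u * 2 ^ (2 * powerSum u i)
selfPowerProduct-lower u zero = ≤-reflexive (sym (trans (*-identityʳ (1 ^ suc u)) (^-zeroˡ (suc u))))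
selfPowerProduct-lower u (suc i) = begin
    suc i ^ (suc i ^ t)
  ≤⟨ self-power-step i u ⟩
    i ^ (i ^ t) * (suc i ^ W) ^ t * 4 ^ (i ^ u)
  ≤⟨ *-mono-≤ (*-monoˡ-≤ ((suc i ^ W) ^ t) (selfPowerProduct-lower u i)) (^-monoʳ-≤ 4 (^-monoˡ-≤ u (n≤1+n i))) ⟩
    V ^ t * 2 ^ (2 * S) * (suc i ^ W) ^ t * (2 ^ 2) ^ W
  ≡⟨ cong (V ^ t * 2 ^ (2 * S) * (suc i ^ W) ^ t *_) (^-*-assoc 2 2 W) ⟩
    V ^ t * 2 ^ (2 * S) * (suc i ^ W) ^ t * 2 ^ (2 * W)
  ≡⟨ interchange (V ^ t) (2 ^ (2 * S)) ((suc i ^ W) ^ t) (2 ^ (2 * W)) ⟩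
    (V ^ t * (suc i ^ W) ^ t) * (2 ^ (2 * S) * 2 ^ (2 * W))
  ≡⟨ sym (cong₂ _*_ (power-of-product V (suc i ^ W) t)
                    (trans (cong (2 ^_) (*-distribˡ-+ 2 S W)) (^-distribˡ-+-* 2 (2 * S) (2 * W)))) ⟩
    (V * suc i ^ W) ^ t * 2 ^ (2 * (S + W)) ∎
  where
  open ≤-Reasoning
  t = suc u
  S = powerSum u i
  V = selfPowerProduct u i
  W = suc i ^ u
  interchange : ∀ a b c d → a * b * c * d ≡ (a * c) * (b * d)
  interchange = solve-∀

selfPowerProduct-close : ∀ u j →
  Close (2 * ((2 + u) * suc j ^ suc u)) (selfPowerProduct u (suc j) ^ suc u) (suc j ^ (suc j ^ suc u))
selfPowerProduct-close u j = upper , lower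
  where
  i = suc j
  t = suc u
  S = powerSum u i
  L = (2 + u) * i ^ t
  L≤2L : L ≤ 2 * L
  L≤2L = m≤m+n L (L + 0)
  S≤L : S ≤ L
  S≤L = ≤-trans (m≤n*m S t) (powerSum-linear u j)
  upper : selfPowerProduct u i ^ t ≤ i ^ (i ^ t) * 2 ^ (2 * L)
  upper = begin
      selfPowerProduct u i ^ t       ≤⟨ ^-monoˡ-≤ t (selfPowerProduct-upper u i) ⟩
      (i ^ S) ^ t                    ≡⟨ ^-*-assoc i S t ⟩
      i ^ (S * t)                    ≤⟨ ^-monoʳ-≤ i (≤-trans (≤-reflexive (*-comm S t)) (powerSum-bound u i)) ⟩
      i ^ (i ^ t + t * i ^ u)        ≡⟨ ^-distribˡ-+-* i (i ^ t) (t * i ^ u) ⟩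
      i ^ (i ^ t) * i ^ (t * i ^ u)  ≤⟨ *-monoʳ-≤ (i ^ (i ^ t)) (^-monoˡ-≤ (t * i ^ u) (n≤2^n i)) ⟩
      i ^ (i ^ t) * (2 ^ i) ^ (t * i ^ u)
        ≡⟨ cong (i ^ (i ^ t) *_) (trans (^-*-assoc 2 i (t * i ^ u)) (cong (2 ^_) (e i t (i ^ u)))) ⟩
      i ^ (i ^ t) * 2 ^ (t * i ^ t)  ≤⟨ *-monoʳ-≤ (i ^ (i ^ t)) (^-monoʳ-≤ 2 (≤-trans (*-monoˡ-≤ (i ^ t) (n≤1+n t)) L≤2L)) ⟩
      i ^ (i ^ t) * 2 ^ (2 * L)      ∎
    where
    open ≤-Reasoning
    e : ∀ i t x → i * (t * x) ≡ t * (i * x)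
    e = solve-∀
  lower : i ^ (i ^ t) ≤ selfPowerProduct u i ^ t * 2 ^ (2 * L)
  lower = ≤-trans (selfPowerProduct-lower u i)
                  (*-monoʳ-≤ (selfPowerProduct u i ^ t) (^-monoʳ-≤ 2 (*-monoʳ-≤ 2 S≤L)))

-- Growth for odd s, by induction along s = 3, 5, 7, …

OddBound : ℕ → ℕ → Set
OddBound u K = ∀ j → Close (K * suc j ^ u) (oddMu u (suc j) ^ (u !)) (suc j ^ (suc j ^ u))

-- s = 3: μ_{3,j} = j + 1 ≤ 2j.
oddBound-base : OddBound 0 1
oddBound-base j = ≤-trans (m≤m+n (suc (suc j) * 1) j) (≤-reflexive (e₁ j))
                , ≤-trans (m≤m+n (suc j * 1) (3 + j)) (≤-reflexive (e₂ j))
  where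
  e₁ : ∀ j → (2 + j) * 1 + j ≡ (1 + j) * 1 * 2
  e₁ = solve-∀
  e₂ : ∀ j → (1 + j) * 1 + (3 + j) ≡ (2 + j) * 1 * 2
  e₂ = solve-∀

-- μ_{2u+5, i} = ∏_{j≤i} μ_{2u+3, j}, so its u!-th power is ≈ V_u(i).
oddMu-close-product : ∀ u K → OddBound u K → ∀ i →
  Close (K * powerSum u i) (oddMu (suc u) i ^ (u !)) (selfPowerProduct u i)
oddMu-close-product u K bound zero = subst (λ x → Close (K * 0) x 1) (sym (^-zeroˡ (u !))) (Close-refl (K * 0) 1)
oddMu-close-product u K bound (suc i) =
  subst (λ x → Close (K * powerSum u (suc i)) x (selfPowerProduct u (suc i)))
        (sym (power-of-product (oddMu (suc u) i) (oddMu u (suc i)) (u !)))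
        (Close-mono (≤-reflexive (sym (*-distribˡ-+ K (powerSum u i) (suc i ^ u))))
                    (Close-* {K * powerSum u i} {K * suc i ^ u} (oddMu-close-product u K bound i) (bound i)))

-- From s = 2u+3 to s = 2u+5: compare μ_{2u+5,i}^{(u+1)!} with V_u(i)^(u+1),
-- then V_u(i)^(u+1) with i^(i^(u+1)); both errors are O(i^(u+1)).
oddBound-step : ∀ u K → OddBound u K → OddBound (suc u) ((K + 2) * (2 + u))
oddBound-step u K bound j =
  Close-mono exponent-bound (Close-trans {K * S * t} {2 * L} raised (selfPowerProduct-close u j))
  where
  i = suc j
  t = suc u
  S = powerSum u i
  L = (2 + u) * i ^ t
  raised : Close (K * S * t) (oddMu t i ^ (t !)) (selfPowerProduct u i ^ t)
  raised = subst (λ x → Close (K * S * t) x (selfPowerProduct u i ^ t))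
                 (trans (^-*-assoc (oddMu t i) (u !) t) (cong (oddMu t i ^_) (*-comm (u !) t)))
                 (Close-^ {K * S} t (oddMu-close-product u K bound i))
  exponent-bound : K * S * t + 2 * L ≤ (K + 2) * (2 + u) * i ^ t
  exponent-bound = begin
      K * S * t + 2 * L    ≡⟨ cong (_+ 2 * L) (trans (*-assoc K S t) (cong (K *_) (*-comm S t))) ⟩
      K * (t * S) + 2 * L  ≤⟨ +-monoˡ-≤ (2 * L) (*-monoʳ-≤ K (powerSum-linear u j)) ⟩
      K * L + 2 * L        ≡⟨ e K u (i ^ t) ⟩
      (K + 2) * (2 + u) * i ^ t ∎
    where
    open ≤-Reasoning
    e : ∀ K u X → K * ((2 + u) * X) + 2 * ((2 + u) * X) ≡ (K + 2) * (2 + u) * X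
    e = solve-∀

oddBound : ∀ u → ∃[ K ] OddBound u K
oddBound zero = 1 , oddBound-base
oddBound (suc u) with oddBound u
... | K , bound = (K + 2) * (2 + u) , oddBound-step u K bound

EvenClaim : ℕ → ℕ → Set
EvenClaim s t = ((i : ℕ) → mu s i ≡ 2 ^ ((i + t ∸ 1) C t))
  × (∃[ K ] ∃[ N ] ((i : ℕ) → N ≤ i →
      (i * ((t !) * ((i + t ∸ 1) C t)) ≤ i * i ^ t + K * i ^ t)
      × (i * i ^ t ≤ i * ((t !) * ((i + t ∸ 1) C t)) + K * i ^ t)))

OddClaim : ℕ → ℕ → Set
OddClaim s t = ((i : ℕ) → mu s i ≡ prodUpTo i (λ l → (i + 1 ∸ l) ^ ((l + t ∸ 1) C (t ∸ 1))))
  × (∃[ K ] ∃[ N ] ((i : ℕ) → N ≤ i → Close (K * i ^ t) (mu s i ^ (t !)) (i ^ (i ^ t))))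

even-claim : ∀ t → EvenClaim (suc t * 2) t
even-claim t = mu-even t , even-growth t

odd-claim : ∀ u → OddClaim (suc (suc (suc u) * 2)) (suc u)
odd-claim u = closed-form , growth (oddBound (suc u))
  where
  closed-form : ∀ i → oddMu (suc u) i ≡ prodUpTo i (λ l → (i + 1 ∸ l) ^ oddExp u l)
  closed-form i = trans (mu-odd u i) (sym (trans (prodUpTo≡prodBelow i (λ l → (i + 1 ∸ l) ^ oddExp u l))
    (prodBelow-cong (suc i) (λ l → cong (λ n → (n ∸ l) ^ oddExp u l) (+-comm i 1)))))
  growth : ∃[ K ] OddBound (suc u) K →
    ∃[ K ] ∃[ N ] ((i : ℕ) → N ≤ i → Close (K * i ^ suc u) (oddMu (suc u) i ^ (suc u !)) (i ^ (i ^ suc u)))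
  growth (K , bound) = K , 1 , λ { zero () ; (suc j) _ → bound j }

half-even : ∀ t → (suc t * 2 ∸ 2) / 2 ≡ t
half-even t = m*n/n≡m t 2

half-odd : ∀ u → (suc (suc (suc u) * 2) ∸ 2) / 2 ≡ suc u
half-odd u = trans (+-distrib-/-∣ʳ 1 {suc u * 2} {2} (divides (suc u) refl)) (m*n/n≡m (suc u) 2)

odd-form : ∀ s → ¬ (2 ∣ s) → ∃[ h ] s ≡ suc (h * 2)
odd-form zero odd = ⊥-elim (odd (divides 0 refl))
odd-form (suc zero) _ = 0 , refl
odd-form (suc (suc s)) odd with odd-form s (λ 2∣s → odd (∣m∣n⇒∣m+n ∣-refl 2∣s))
... | h , refl = suc h , refl

even-case : ∀ s → 2 ≤ s → 2 ∣ s → EvenClaim s ((s ∸ 2) / 2)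
even-case _ () (divides zero refl)
even-case _ _ (divides (suc t) refl) = subst (EvenClaim (suc t * 2)) (sym (half-even t)) (even-claim t)

odd-case : ∀ s → 5 ≤ s → ¬ (2 ∣ s) → OddClaim s ((s ∸ 2) / 2)
odd-case s 5≤s odd with odd-form s odd
... | suc (suc u) , refl = subst (OddClaim (suc (suc (suc u) * 2))) (sym (half-odd u)) (odd-claim u)
odd-case _ (s≤s ()) _ | zero , refl
odd-case _ (s≤s (s≤s (s≤s ()))) _ | suc zero , refl

lemma2p6 : ((s : ℕ) → 2 ≤ s → 2 ∣ s →
    let t = (s ∸ 2) / 2 in
    ((i : ℕ) → mu s i ≡ 2 ^ ((i + t ∸ 1) C t))
    × (∃[ K ] ∃[ N ] ((i : ℕ) → N ≤ i →
    (i * ((t !) * ((i + t ∸ 1) C t)) ≤ i * i ^ t + K * i ^ t)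
    × (i * i ^ t ≤ i * ((t !) * ((i + t ∸ 1) C t)) + K * i ^ t))))
    ×
    ((s : ℕ) → 5 ≤ s → ¬ (2 ∣ s) →
    let t = (s ∸ 2) / 2 in
    ((i : ℕ) → mu s i ≡ prodUpTo i (λ l → (i + 1 ∸ l) ^ ((l + t ∸ 1) C (t ∸ 1))))
    × (∃[ K ] ∃[ N ] ((i : ℕ) → N ≤ i →
    (mu s i ^ (t !) ≤ i ^ (i ^ t) * 2 ^ (K * i ^ t))
    × (i ^ (i ^ t) ≤ mu s i ^ (t !) * 2 ^ (K * i ^ t)))))
lemma2p6 = even-case , odd-case
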